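{- If $T$ and $T'$ are unrooted binary trees on the same set of $n$ taxa that precisely satisfy $(n-3)$-interval cospeciation, then at least one of $T,T'$ is a caterpillar tree.
   Context: An unrooted binary tree is a tree in which every non-leaf vertex has degree three, with leaves labeled by taxa. $\varepsilon_T(A,B)$ is the number of edges on the path between taxa $A$ and $B$ in $T$. Two trees satisfy $k$-interval cospeciation ($k$-IC) if $\lvert \varepsilon_{T_1}(A,B)-\varepsilon_{T_2}(A,B)\rvert\le k$ for all pairs of taxa; they precisely satisfy $k$-IC if they satisfy $k$-IC but not $(k-1)$-IC. A cherry is a pair of taxa with exactly two edges between them; a caterpillar tree is an unrooted binary tree with exactly two cherries. -}

module Defs where

open import Data.Nat using (ℕ; zero; suc; _+_; _≤_; _∸_; ∣_-_∣)
open import Data.Fin using (Fin)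
open import Data.Bool using (Bool; true; false; if_then_else_)
open import Data.List using (List; []; _∷_; length; map; head; last; allFin)
open import Data.Nat.ListAction using (sum)
open import Data.List.Relation.Unary.Linked using (Linked)
open import Data.List.Relation.Unary.Unique.Propositional using (Unique)
open import Data.Maybe using (just)
open import Data.Product using (Σ; _×_; ∃; ∃-syntax)
open import Data.Sum using (_⊎_)
open import Relation.Binary.PropositionalEquality using (_≡_; _≢_)
open import Relation.Nullary using (¬_)
open import Function.Definitions using (Injective)

Adjacent : {m : ℕ} → (Fin m → Fin m → Bool) → Fin m → Fin m → Set
Adjacent adj u v = adj u v ≡ true

degree : {m : ℕ} → (Fin m → Fin m → Bool) → Fin m → ℕ
degree {m} adj v = sum (map (λ w → if adj v w then 1 else 0) (allFin m))

SimplePath : {m : ℕ} → (Fin m → Fin m → Bool) → Fin m → Fin m → ℕ → Set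
SimplePath {m} adj u v d =
  Σ (List (Fin m)) λ p →
    Linked (Adjacent adj) p × Unique p ×
    head p ≡ just u × last p ≡ just v × length p ≡ suc d

HasCycle : {m : ℕ} → (Fin m → Fin m → Bool) → Set
HasCycle {m} adj =
  Σ (Fin m) λ u → Σ (List (Fin m)) λ p → Σ (Fin m) λ w →
    Linked (Adjacent adj) (u ∷ p) × Unique (u ∷ p) ×
    2 ≤ length p × last (u ∷ p) ≡ just w × Adjacent adj w u

record UnrootedBinaryTree (n : ℕ) : Set where
  field
    m         : ℕ
    adj       : Fin m → Fin m → Bool
    symmetric : ∀ u v → adj u v ≡ adj v u
    irreflex  : ∀ v → adj v v ≡ false
    connected : ∀ u v → ∃[ d ] SimplePath adj u v d
    acyclic   : ¬ HasCycle adj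
    deg13     : ∀ v → degree adj v ≡ 1 ⊎ degree adj v ≡ 3
    leaf      : Fin n → Fin m
    leaf-inj  : Injective _≡_ _≡_ leaf
    leaf-deg  : ∀ i → degree adj (leaf i) ≡ 1
    leaf-surj : ∀ v → degree adj v ≡ 1 → ∃[ i ] leaf i ≡ v

open UnrootedBinaryTree public

-- ε_T(A,B) = d : the path between taxa A and B in T has d edges.
-- (In a tree the simple path between two vertices is unique, so this is
-- the graph of the function ε_T.)
Eps : {n : ℕ} → UnrootedBinaryTree n → Fin n → Fin n → ℕ → Set
Eps T A B d = SimplePath (adj T) (leaf T A) (leaf T B) d

IC : {n : ℕ} → ℕ → UnrootedBinaryTree n → UnrootedBinaryTree n → Set
IC {n} k T₁ T₂ = ∀ (A B : Fin n) (d₁ d₂ : ℕ) →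
  Eps T₁ A B d₁ → Eps T₂ A B d₂ → ∣ d₁ - d₂ ∣ ≤ k

-- precisely k-IC, for k ≥ 1 (written with k = suc j so that k - 1 = j)
PreciselyIC : {n : ℕ} → ℕ → UnrootedBinaryTree n → UnrootedBinaryTree n → Set
PreciselyIC (suc j) T₁ T₂ = IC (suc j) T₁ T₂ × ¬ IC j T₁ T₂
PreciselyIC zero    T₁ T₂ = IC zero T₁ T₂   -- (−1)-IC never holds when n ≥ 2

Cherry : {n : ℕ} → UnrootedBinaryTree n → Fin n → Fin n → Set
Cherry T A B = A ≢ B × Eps T A B 2

SamePair : {n : ℕ} → Fin n → Fin n → Fin n → Fin n → Set
SamePair A B C D = (A ≡ C × B ≡ D) ⊎ (A ≡ D × B ≡ C)

Caterpillar : {n : ℕ} → UnrootedBinaryTree n → Set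
Caterpillar {n} T = Σ (Fin n) λ A → Σ (Fin n) λ B → Σ (Fin n) λ C → Σ (Fin n) λ D →
  Cherry T A B × Cherry T C D × ¬ SamePair A B C D ×
  (∀ X Y → Cherry T X Y → SamePair X Y A B ⊎ SamePair X Y C D)

module Submission where

-- Since (n−4)-IC fails, some taxa A, B have path lengths in T and T′ that
-- differ by more than n−4.  Distinct leaves of a tree with at least three
-- leaves are at distance ≥ 2, so in one tree, say T, the A–B path has
-- d ≥ n−1 edges.  Each of its d−1 interior vertices v has degree 3, hence a
-- neighbour w off the path; leaving the path through w leads to a leaf.
-- Leaves reached from different interior vertices are different, because
-- paths in a tree are unique, and if w is not a leaf it leads to two leaves.
-- T has only n leaves, so every such w is a leaf and every leaf is adjacent
-- to the path: T is a caterpillar whose two cherries sit at the ends of the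
-- path.

open import Defs
open import Data.Nat using (ℕ; zero; suc; _+_; _≤_; _<_; _∸_; z≤n; s≤s; ∣_-_∣; _≤?_)
open import Data.Nat.Properties
  using (≤-refl; ≤-reflexive; ≤-trans; <⇒≤; <⇒≱; ≰⇒>; +-mono-≤; +-monoˡ-≤; m≤m+n; m≤n+m; <-irrefl; +-comm;
         +-suc; suc-injective; +-commutativeSemigroup)
open import Algebra.Properties.CommutativeSemigroup +-commutativeSemigroup using (interchange)
open import Data.Fin using (Fin) renaming (_≟_ to _≟F_)
open import Data.Fin.Properties using (any?)
open import Data.Bool using (Bool; true; false; if_then_else_)
import Data.Bool as Bool
open import Data.List using (List; []; _∷_; _++_; _ʳ++_; reverse; length; map; last; allFin; [_])
open import Data.List.Properties
  using (length-tabulate; length-++; length-++-≤ˡ; ++-assoc; ++-cancelˡ; ∷-injective; ∷-injectiveˡ; ∷-injectiveʳ;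
         ∷ʳ-injectiveˡ; ʳ++-defn)
open import Data.Nat.ListAction using (sum)
open import Data.List.Relation.Unary.Linked using (Linked; []; [-]; _∷_)
open import Data.List.Relation.Unary.All as All using (All; []; _∷_)
import Data.List.Relation.Unary.All.Properties as AllP
open import Data.List.Relation.Unary.Any using (here; there)
import Data.List.Relation.Unary.Any.Properties as AnyP
open import Data.List.Relation.Unary.AllPairs using ([]; _∷_)
open import Data.List.Relation.Unary.Unique.Propositional using (Unique)
open import Data.List.Relation.Unary.Unique.Propositional.Properties using (allFin⁺)
open import Data.List.Membership.Propositional using (_∈_; _∉_)
open import Data.List.Membership.Propositional.Properties using (∈-allFin; ∈-∃++; ∈-++⁺ˡ; ∈-++⁺ʳ)
import Data.List.Membership.DecPropositional as DecMembership
open import Data.Maybe using (just)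
open import Data.Maybe.Properties using (just-injective)
open import Data.Product using (Σ; _×_; _,_; proj₁; proj₂)
open import Data.Sum using (_⊎_; inj₁; inj₂)
import Data.Sum as Sum
open import Data.Empty using (⊥; ⊥-elim)
open import Data.Unit using (⊤; tt)
open import Relation.Binary.PropositionalEquality hiding ([_])
open import Relation.Nullary using (¬_; Dec; yes; no; does)
open import Relation.Nullary.Decidable using (¬?; _×-dec_; dec-true)

module _ {A : Set} where

  lastOf : A → List A → A
  lastOf a []       = a
  lastOf a (b ∷ xs) = lastOf b xs

  last-∷ : ∀ a xs → last (a ∷ xs) ≡ just (lastOf a xs)
  last-∷ a []       = refl
  last-∷ a (b ∷ xs) = last-∷ b xs

  lastOf-∈ : ∀ a xs → lastOf a xs ∈ a ∷ xs
  lastOf-∈ a []       = here refl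
  lastOf-∈ a (b ∷ xs) = there (lastOf-∈ b xs)

  lastOf-++-∷ : ∀ a xs v ys → lastOf a (xs ++ v ∷ ys) ≡ lastOf v ys
  lastOf-++-∷ a []       v ys = refl
  lastOf-++-∷ a (b ∷ xs) v ys = lastOf-++-∷ b xs v ys

  Linked-++⁻ˡ : ∀ {R : A → A → Set} xs {ys} → Linked R (xs ++ ys) → Linked R xs
  Linked-++⁻ˡ []           _       = []
  Linked-++⁻ˡ (x ∷ [])     _       = [-]
  Linked-++⁻ˡ (x ∷ y ∷ xs) (r ∷ l) = r ∷ Linked-++⁻ˡ (y ∷ xs) l

  Unique-++⁻ˡ : ∀ (xs : List A) {ys} → Unique (xs ++ ys) → Unique xs
  Unique-++⁻ˡ []       _       = []
  Unique-++⁻ˡ (x ∷ xs) (a ∷ u) = AllP.++⁻ˡ xs a ∷ Unique-++⁻ˡ xs u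

  Linked-junction : ∀ {R : A → A → Set} a xs y ys → Linked R (a ∷ xs ++ y ∷ ys) → R (lastOf a xs) y
  Linked-junction a []       y ys (r ∷ _) = r
  Linked-junction a (b ∷ xs) y ys (_ ∷ l) = Linked-junction b xs y ys l

  Linked-after : ∀ {R : A → A → Set} a xs y z ys → Linked R (a ∷ xs ++ y ∷ z ∷ ys) → R y z
  Linked-after a []       y z ys (_ ∷ r ∷ _) = r
  Linked-after a (b ∷ xs) y z ys (_ ∷ l)     = Linked-after b xs y z ys l

  Unique-disjoint : ∀ {x : A} xs {ys} → Unique (xs ++ ys) → x ∈ xs → x ∈ ys → ⊥
  Unique-disjoint (_ ∷ xs) (a ∷ _) (here refl) q = AllP.All¬⇒¬Any (AllP.++⁻ʳ xs a) q
  Unique-disjoint (_ ∷ xs) (_ ∷ u) (there p)   q = Unique-disjoint xs u p q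

count : {A : Set} → (A → Bool) → List A → ℕ
count f L = sum (map (λ z → if f z then 1 else 0) L)

indicator : Bool → ℕ
indicator b = if b then 1 else 0

does-true : {P : Set} (d : Dec P) → does d ≡ true → P
does-true (yes p) _ = p

module _ {A : Set} where

  sum-map-mono : (φ ψ : A → ℕ) → (∀ z → φ z ≤ ψ z) → ∀ L → sum (map φ L) ≤ sum (map ψ L)
  sum-map-mono φ ψ φ≤ψ []      = z≤n
  sum-map-mono φ ψ φ≤ψ (x ∷ L) = +-mono-≤ (φ≤ψ x) (sum-map-mono φ ψ φ≤ψ L)

  sum-map-+ : (φ ψ : A → ℕ) → ∀ L → sum (map (λ z → φ z + ψ z) L) ≡ sum (map φ L) + sum (map ψ L)
  sum-map-+ φ ψ []      = refl
  sum-map-+ φ ψ (x ∷ L) =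
    trans (cong (φ x + ψ x +_) (sum-map-+ φ ψ L)) (interchange (φ x) (ψ x) _ _)

  count-≤-+ : (f g h : A → Bool) → (∀ z → h z ≡ true → f z ≡ true ⊎ g z ≡ true) →
    ∀ L → count h L ≤ count f L + count g L
  count-≤-+ f g h cover L =
    ≤-trans (sum-map-mono _ _ pointwise L) (≤-reflexive (sum-map-+ _ _ L))
    where
    pointwise : ∀ z → indicator (h z) ≤ indicator (f z) + indicator (g z)
    pointwise z with h z in hz | f z in fz | g z in gz
    ... | false | _     | _     = z≤n
    ... | true  | true  | _     = s≤s z≤n
    ... | true  | false | true  = ≤-refl
    ... | true  | false | false with cover z hz
    ...   | inj₁ fz′ with () ← trans (sym fz′) fz
    ...   | inj₂ gz′ with () ← trans (sym gz′) gz

  count-+-≤ : (f g h : A → Bool) → (∀ z → f z ≡ true → g z ≡ true → ⊥) →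
    (∀ z → f z ≡ true ⊎ g z ≡ true → h z ≡ true) → ∀ L → count f L + count g L ≤ count h L
  count-+-≤ f g h disjoint cover L =
    ≤-trans (≤-reflexive (sym (sum-map-+ _ _ L))) (sum-map-mono _ _ pointwise L)
    where
    pointwise : ∀ z → indicator (f z) + indicator (g z) ≤ indicator (h z)
    pointwise z with f z in fz | g z in gz | h z in hz
    ... | false | false | _     = z≤n
    ... | true  | true  | _     = ⊥-elim (disjoint z fz gz)
    ... | true  | false | true  = ≤-refl
    ... | false | true  | true  = ≤-refl
    ... | true  | false | false with () ← trans (sym (cover z (inj₁ fz))) hz
    ... | false | true  | false with () ← trans (sym (cover z (inj₂ gz))) hz

  count-true : ∀ (L : List A) → count (λ _ → true) L ≡ length L
  count-true []      = refl
  count-true (x ∷ L) = cong suc (count-true L)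

module FinCounting (k : ℕ) where
  open DecMembership (_≟F_ {k}) using (_∈?_)

  is : Fin k → Fin k → Bool
  is s z = does (z ≟F s)

  isIn : List (Fin k) → Fin k → Bool
  isIn S z = does (z ∈? S)

  count-is-≤1 : ∀ s L → Unique L → count (is s) L ≤ 1
  count-is-≤1 s []      _       = z≤n
  count-is-≤1 s (x ∷ L) (a ∷ u) with x ≟F s
  ... | no _     = count-is-≤1 s L u
  ... | yes refl = s≤s (≤-reflexive (absent L a))
    where
    absent : ∀ L → All (s ≢_) L → count (is s) L ≡ 0
    absent []      []       = refl
    absent (y ∷ L) (p ∷ ps) with y ≟F s
    ... | yes refl = ⊥-elim (p refl)
    ... | no _     = absent L ps

  count-is-≥1 : ∀ s L → s ∈ L → 1 ≤ count (is s) L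
  count-is-≥1 s (x ∷ L) (here refl) rewrite dec-true (x ≟F x) refl = s≤s z≤n
  count-is-≥1 s (x ∷ L) (there p)   = ≤-trans (count-is-≥1 s L p) (m≤n+m _ _)

  count-isIn : ∀ S L → Unique S → (∀ s → s ∈ S → s ∈ L) → length S ≤ count (isIn S) L
  count-isIn []      L _       _   = z≤n
  count-isIn (s ∷ S) L (a ∷ u) S⊆L =
    ≤-trans (+-mono-≤ (count-is-≥1 s L (S⊆L s (here refl))) (count-isIn S L u (λ x p → S⊆L x (there p))))
            (count-+-≤ (is s) (isIn S) (isIn (s ∷ S)) disjoint cover L)
    where
    disjoint : ∀ z → is s z ≡ true → isIn S z ≡ true → ⊥
    disjoint z zs zS with does-true (z ≟F s) zs
    ... | refl = AllP.All¬⇒¬Any a (does-true (z ∈? S) zS)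
    cover : ∀ z → is s z ≡ true ⊎ isIn S z ≡ true → isIn (s ∷ S) z ≡ true
    cover z (inj₁ zs) = dec-true (z ∈? (s ∷ S)) (here (does-true (z ≟F s) zs))
    cover z (inj₂ zS) = dec-true (z ∈? (s ∷ S)) (there (does-true (z ∈? S) zS))

  unique-count : ∀ f S → Unique S → All (λ s → f s ≡ true) S → length S ≤ count f (allFin k)
  unique-count f S u fS =
    ≤-trans (count-isIn S (allFin k) u (λ s _ → ∈-allFin s)) (sum-map-mono _ _ pointwise (allFin k))
    where
    pointwise : ∀ z → indicator (isIn S z) ≤ indicator (f z)
    pointwise z with z ∈? S
    ... | no _  = z≤n
    ... | yes p rewrite All.lookup fS p = ≤-refl

  count-all : count (λ _ → true) (allFin k) ≡ k
  count-all = trans (count-true (allFin k)) (length-tabulate {n = k} (λ x → x))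

  unique-length : ∀ S → Unique S → length S ≤ k
  unique-length S u =
    ≤-trans (unique-count (λ _ → true) S u (All.universal (λ _ → refl) S)) (≤-reflexive count-all)

  count-two : ∀ f x y → (∀ z → f z ≡ true → z ≡ x ⊎ z ≡ y) → count f (allFin k) ≤ 2
  count-two f x y only =
    ≤-trans (count-≤-+ (is x) (is y) f cover (allFin k))
            (+-mono-≤ (count-is-≤1 x (allFin k) (allFin⁺ k)) (count-is-≤1 y (allFin k) (allFin⁺ k)))
    where
    cover : ∀ z → f z ≡ true → is x z ≡ true ⊎ is y z ≡ true
    cover z fz with only z fz
    ... | inj₁ refl = inj₁ (dec-true (z ≟F z) refl)
    ... | inj₂ refl = inj₂ (dec-true (z ≟F z) refl)

module Tree {n : ℕ} (T : UnrootedBinaryTree n) where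
  open FinCounting (m T) using (unique-count; count-two; unique-length)

  V : Set
  V = Fin (m T)

  Adj : V → V → Set
  Adj = Adjacent (adj T)

  deg : V → ℕ
  deg = degree (adj T)

  adj-sym : ∀ {x y} → Adj x y → Adj y x
  adj-sym {x} {y} = trans (symmetric T y x)

  adj-irrefl : ∀ {x y} → Adj x y → x ≢ y
  adj-irrefl {x} xx refl with () ← trans (sym xx) (irreflex T x)

  neighbours≤deg : ∀ v S → Unique S → All (Adj v) S → length S ≤ deg v
  neighbours≤deg v = unique-count (adj T v)

  deg≤3 : ∀ v → deg v ≤ 3
  deg≤3 v with deg13 T v
  ... | inj₁ d1 = ≤-trans (≤-reflexive d1) (s≤s z≤n)
  ... | inj₂ d3 = ≤-reflexive d3

  leaf-neighbour : ∀ {v x y} → deg v ≡ 1 → Adj v x → Adj v y → x ≡ y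
  leaf-neighbour {v} {x} {y} d1 vx vy with x ≟F y
  ... | yes x≡y = x≡y
  ... | no x≢y  = ⊥-elim (<-irrefl refl (≤-trans
        (neighbours≤deg v (x ∷ y ∷ []) ((x≢y ∷ []) ∷ [] ∷ []) (vx ∷ vy ∷ [])) (≤-reflexive d1)))

  internal : ∀ {v x y} → Adj v x → Adj v y → x ≢ y → deg v ≡ 3
  internal {v} vx vy x≢y with deg13 T v
  ... | inj₁ d1 = ⊥-elim (x≢y (leaf-neighbour d1 vx vy))
  ... | inj₂ d3 = d3

  third-neighbour : ∀ {v} → deg v ≡ 3 → ∀ x y → Σ V λ z → Adj v z × z ≢ x × z ≢ y
  third-neighbour {v} d3 x y
    with any? (λ z → (adj T v z Bool.≟ true) ×-dec ¬? (z ≟F x) ×-dec ¬? (z ≟F y))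
  ... | yes found = found
  ... | no none   = ⊥-elim (<-irrefl refl (≤-trans (≤-reflexive (sym d3)) (count-two (adj T v) x y only)))
    where
    only : ∀ z → adj T v z ≡ true → z ≡ x ⊎ z ≡ y
    only z vz with z ≟F x | z ≟F y
    ... | yes z≡x | _       = inj₁ z≡x
    ... | no _    | yes z≡y = inj₂ z≡y
    ... | no z≢x  | no z≢y  = ⊥-elim (none (z , vz , z≢x , z≢y))

  no-four-neighbours : ∀ {v a b c e} → Adj v a → Adj v b → Adj v c → Adj v e →
    a ≢ b → a ≢ c → a ≢ e → b ≢ c → b ≢ e → c ≢ e → ⊥
  no-four-neighbours {v} va vb vc ve a≢b a≢c a≢e b≢c b≢e c≢e = <-irrefl refl (≤-trans
    (neighbours≤deg v _ ((a≢b ∷ a≢c ∷ a≢e ∷ []) ∷ (b≢c ∷ b≢e ∷ []) ∷ (c≢e ∷ []) ∷ [] ∷ [])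
      (va ∷ vb ∷ vc ∷ ve ∷ []))
    (deg≤3 v))

  Simple : List V → Set
  Simple xs = Linked Adj xs × Unique xs

  Simple-++⁻ˡ : ∀ xs {ys} → Simple (xs ++ ys) → Simple xs
  Simple-++⁻ˡ xs (l , u) = Linked-++⁻ˡ xs l , Unique-++⁻ˡ xs u

  -- Non-backtracking walks: consecutive vertices are adjacent and no step
  -- returns to the vertex just left.  In a tree these are the simple paths.
  data NonBacktracking : List V → Set where
    empty  : NonBacktracking []
    single : ∀ {x} → NonBacktracking (x ∷ [])
    edge   : ∀ {x y} → Adj x y → NonBacktracking (x ∷ y ∷ [])
    turn   : ∀ {x y z r} → Adj x y → x ≢ z → NonBacktracking (y ∷ z ∷ r) → NonBacktracking (x ∷ y ∷ z ∷ r)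

  NB-tail : ∀ {x xs} → NonBacktracking (x ∷ xs) → NonBacktracking xs
  NB-tail single       = empty
  NB-tail (edge _)     = single
  NB-tail (turn _ _ w) = w

  NB-first : ∀ {x y r} → NonBacktracking (x ∷ y ∷ r) → Adj x y
  NB-first (edge xy)     = xy
  NB-first (turn xy _ _) = xy

  NB⇒Linked : ∀ {xs} → NonBacktracking xs → Linked Adj xs
  NB⇒Linked empty         = []
  NB⇒Linked single        = [-]
  NB⇒Linked (edge xy)     = xy ∷ [-]
  NB⇒Linked (turn xy _ w) = xy ∷ NB⇒Linked w

  -- A non-backtracking walk whose tail is repetition-free never returns to
  -- its first vertex x: a return would close a cycle of T (or be a loop, or
  -- an immediate turn back).
  no-return : ∀ {x xs} → NonBacktracking (x ∷ xs) → Unique xs → x ∉ xs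
  no-return {x} w u x∈xs with pre , post , refl ← ∈-∃++ x∈xs =
    closes pre w u (λ x∈pre → Unique-disjoint pre u x∈pre (here refl))
    where
    closes : ∀ pre → NonBacktracking (x ∷ pre ++ x ∷ post) → Unique (pre ++ x ∷ post) → x ∉ pre → ⊥
    closes []            w _ _     = adj-irrefl (NB-first w) refl
    closes (y ∷ [])      (turn _ x≢x _) _ _ = x≢x refl
    closes (y ∷ z ∷ pre) w u x∉pre = acyclic T
      (x , y ∷ z ∷ pre , lastOf x (y ∷ z ∷ pre) ,
       Linked-++⁻ˡ (x ∷ y ∷ z ∷ pre) linked ,
       AllP.¬Any⇒All¬ _ x∉pre ∷ Unique-++⁻ˡ (y ∷ z ∷ pre) u ,
       s≤s (s≤s z≤n) , last-∷ x (y ∷ z ∷ pre) , Linked-junction x (y ∷ z ∷ pre) x post linked)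
      where
      linked : Linked Adj (x ∷ y ∷ z ∷ pre ++ x ∷ post)
      linked = NB⇒Linked w

  NB⇒Simple : ∀ {xs} → NonBacktracking xs → Simple xs
  NB⇒Simple {[]}     w = [] , []
  NB⇒Simple {x ∷ xs} w = NB⇒Linked w , AllP.¬Any⇒All¬ xs (no-return w u) ∷ u
    where
    u : Unique xs
    u = proj₂ (NB⇒Simple (NB-tail w))

  Simple⇒NB : ∀ {xs} → Simple xs → NonBacktracking xs
  Simple⇒NB ([] , _)                             = empty
  Simple⇒NB ([-] , _)                            = single
  Simple⇒NB (xy ∷ [-] , _)                       = edge xy
  Simple⇒NB (xy ∷ (yz ∷ l) , (_ ∷ x≢z ∷ _) ∷ u) = turn xy x≢z (Simple⇒NB (yz ∷ l , u))

  -- Two walks leaving a in different directions: following the first one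
  -- backwards into a and then the second one is non-backtracking.
  DifferentHeads : List V → List V → Set
  DifferentHeads (c ∷ _) (d ∷ _) = c ≢ d
  DifferentHeads _       _       = ⊤

  glue : ∀ xs a acc → NonBacktracking (a ∷ acc) → NonBacktracking (a ∷ xs) → DifferentHeads xs acc →
    NonBacktracking (xs ʳ++ (a ∷ acc))
  glue []       a acc wa _  _     = wa
  glue (c ∷ xs) a acc wa wx heads = glue xs c (a ∷ acc) (back acc wa heads) (NB-tail wx) (heads′ xs wx)
    where
    back : ∀ acc → NonBacktracking (a ∷ acc) → DifferentHeads (c ∷ xs) acc → NonBacktracking (c ∷ a ∷ acc)
    back []      _  _   = edge (adj-sym (NB-first wx))
    back (_ ∷ _) wa c≢d = turn (adj-sym (NB-first wx)) c≢d wa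
    heads′ : ∀ xs → NonBacktracking (a ∷ c ∷ xs) → DifferentHeads xs (a ∷ acc)
    heads′ []      _              = tt
    heads′ (_ ∷ _) (turn _ a≢e _) = λ e≡a → a≢e (sym e≡a)

  no-reconvergence : ∀ p x y r₁ r₂ → Simple (p ∷ x ∷ r₁) → Simple (p ∷ y ∷ r₂) → x ≢ y →
    lastOf x r₁ ≢ lastOf y r₂
  no-reconvergence p x y r₁ r₂ s₁ s₂ x≢y same =
    Unique-disjoint (reverse (x ∷ r₁)) (subst Unique (ʳ++-defn (x ∷ r₁)) (proj₂ (NB⇒Simple glued)))
      (AnyP.reverse⁺ (lastOf-∈ x r₁)) (subst (_∈ p ∷ y ∷ r₂) (sym same) (there (lastOf-∈ y r₂)))
    where
    glued : NonBacktracking ((x ∷ r₁) ʳ++ (p ∷ y ∷ r₂))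
    glued = glue (x ∷ r₁) p (y ∷ r₂) (Simple⇒NB s₂) (Simple⇒NB s₁) x≢y

  path-unique : ∀ a X Y → Simple (a ∷ X) → Simple (a ∷ Y) → lastOf a X ≡ lastOf a Y → X ≡ Y
  path-unique a []      []      _ _ _ = refl
  path-unique a []      (y ∷ Y) _ (_ , a∉ ∷ _) same =
    ⊥-elim (AllP.All¬⇒¬Any a∉ (subst (_∈ y ∷ Y) (sym same) (lastOf-∈ y Y)))
  path-unique a (x ∷ X) []      (_ , a∉ ∷ _) _ same =
    ⊥-elim (AllP.All¬⇒¬Any a∉ (subst (_∈ x ∷ X) same (lastOf-∈ x X)))
  path-unique a (x ∷ X) (y ∷ Y) s₁ s₂ same with x ≟F y
  ... | yes refl = cong (x ∷_) (path-unique x X Y (Simple-tail s₁) (Simple-tail s₂) same)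
    where
    Simple-tail : ∀ {z zs} → Simple (a ∷ z ∷ zs) → Simple (z ∷ zs)
    Simple-tail (_ ∷ l , _ ∷ u) = l , u
  ... | no x≢y   = ⊥-elim (no-reconvergence a x y X Y s₁ s₂ x≢y same)

  Simple-upto : ∀ xs y ys → Simple (xs ++ y ∷ ys) → Simple (xs ++ [ y ])
  Simple-upto xs y ys s = Simple-++⁻ˡ (xs ++ [ y ]) (subst Simple (sym (++-assoc xs [ y ] ys)) s)

  NB-snoc : ∀ x xs {v z} → NonBacktracking (x ∷ xs ++ [ v ]) → Adj v z → lastOf x xs ≢ z →
    NonBacktracking (x ∷ xs ++ v ∷ z ∷ [])
  NB-snoc x []            (edge xv)      vz x≢z = turn xv x≢z (edge vz)
  NB-snoc x (y ∷ [])      (turn xy ne w) vz y≢z = turn xy ne (NB-snoc y [] w vz y≢z)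
  NB-snoc x (y ∷ y′ ∷ xs) (turn xy ne w) vz p≢z = turn xy ne (NB-snoc y (y′ ∷ xs) w vz p≢z)

  -- A simple path can be continued by any edge that does not turn back ...
  extend : ∀ x xs {v z} → Simple (x ∷ xs ++ [ v ]) → Adj v z → lastOf x xs ≢ z →
    Simple (x ∷ xs ++ v ∷ z ∷ [])
  extend x xs s vz ne = NB⇒Simple (NB-snoc x xs (Simple⇒NB s) vz ne)

  -- ... and then on to a leaf.  (The path keeps growing at internal
  -- vertices; it cannot grow beyond m T vertices, which bounds the recursion.)
  leaf-beyond : ∀ x xs u v → Simple (x ∷ xs ++ [ u ]) → Adj u v → lastOf x xs ≢ v →
    Σ (List V) λ X → Simple (x ∷ xs ++ u ∷ v ∷ X) × deg (lastOf v X) ≡ 1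
  leaf-beyond x xs u v = go (m T) xs u v (m≤m+n (m T) (length xs))
    where
    longer : ∀ fuel xs y → fuel + length (xs ++ [ y ]) ≡ suc fuel + length xs
    longer fuel xs y = begin
      fuel + length (xs ++ [ y ]) ≡⟨ cong (fuel +_) (length-++ xs) ⟩
      fuel + (length xs + 1)      ≡⟨ cong (fuel +_) (+-comm (length xs) 1) ⟩
      fuel + suc (length xs)      ≡⟨ +-suc fuel (length xs) ⟩
      suc fuel + length xs        ∎
      where open ≡-Reasoning

    go : ∀ fuel xs u v → m T ≤ fuel + length xs → Simple (x ∷ xs ++ [ u ]) → Adj u v → lastOf x xs ≢ v →
      Σ (List V) λ X → Simple (x ∷ xs ++ u ∷ v ∷ X) × deg (lastOf v X) ≡ 1
    go fuel xs u v bound s uv ne with deg13 T v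
    ... | inj₁ d1 = [] , extend x xs s uv ne , d1
    go zero xs u v bound s uv ne | inj₂ _ =
      ⊥-elim (<-irrefl refl (≤-trans (unique-length _ (proj₂ s)) (≤-trans bound (length-++-≤ˡ xs))))
    go (suc fuel) xs u v bound s uv ne | inj₂ d3 =
      let (z , vz , z≢u , _) = third-neighbour d3 u u
          (X , sX , leafX) = go fuel (xs ++ [ u ]) v z
            (≤-trans bound (≤-reflexive (sym (longer fuel xs u))))
            (subst (λ l → Simple (x ∷ l)) (sym (++-assoc xs [ u ] [ v ])) (extend x xs s uv ne))
            vz (subst (_≢ z) (sym (lastOf-++-∷ x xs u [])) (≢-sym z≢u))
      in z ∷ X , subst (λ l → Simple (x ∷ l)) (++-assoc xs [ u ] (v ∷ z ∷ X)) sX , leafX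

  common-prefix : ∀ a Q X Y → Simple (a ∷ Q ++ X) → Simple (a ∷ Q ++ Y) →
    lastOf a (Q ++ X) ≡ lastOf a (Q ++ Y) → X ≡ Y
  common-prefix a Q X Y s₁ s₂ same = ++-cancelˡ Q X Y (path-unique a _ _ s₁ s₂ same)

  branches-differ : ∀ a Q b x y X Y → Simple (a ∷ Q ++ b ∷ x ∷ X) → Simple (a ∷ Q ++ b ∷ y ∷ Y) → x ≢ y →
    lastOf a (Q ++ b ∷ x ∷ X) ≢ lastOf a (Q ++ b ∷ y ∷ Y)
  branches-differ a Q b x y X Y s₁ s₂ x≢y same =
    x≢y (∷-injectiveˡ (∷-injectiveʳ (common-prefix a Q _ _ s₁ s₂ same)))

  off-path : ∀ a Q b w c R → Simple (a ∷ Q ++ b ∷ w ∷ []) → Simple (a ∷ Q ++ b ∷ c ∷ R) → w ≢ c →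
    w ∉ a ∷ Q ++ b ∷ c ∷ R
  off-path a Q b w c R s₁ s₂ w≢c w∈ with ∈-∃++ w∈
  ... | [] , _ , eq =
    Unique-disjoint (a ∷ []) (proj₂ s₁) (here refl) (∈-++⁺ʳ Q (there (here (∷-injectiveˡ eq))))
  ... | _ ∷ q , post , eq with refl , eq′ ← ∷-injective eq =
    w≢c (sym (∷-injectiveˡ (∷-injectiveʳ (++-cancelˡ Q _ _ (begin
      Q ++ b ∷ c ∷ R         ≡⟨ eq′ ⟩
      q ++ w ∷ post          ≡⟨ cong (_++ w ∷ post) q≡Q++b ⟩
      (Q ++ [ b ]) ++ w ∷ post ≡⟨ ++-assoc Q [ b ] (w ∷ post) ⟩
      Q ++ b ∷ w ∷ post      ∎)))))
    where
    open ≡-Reasoning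
    q≡Q++b : q ≡ Q ++ [ b ]
    q≡Q++b = ∷ʳ-injectiveˡ q (Q ++ [ b ]) (trans
      (path-unique a _ _ (Simple-upto (a ∷ q) w post (subst (λ l → Simple (a ∷ l)) eq′ s₂)) s₁
        (trans (lastOf-++-∷ a q w []) (sym (lastOf-++-∷ a Q b (w ∷ [])))))
      (sym (++-assoc Q [ b ] [ w ])))

  TwoNeighboursIn : V → List V → Set
  TwoNeighboursIn v L = Σ V λ p → Σ V λ q → Adj v p × Adj v q × p ≢ q × p ∈ L × q ∈ L

  on-path : ∀ {v} x X → Simple (x ∷ X) → v ∈ x ∷ X → v ≡ x ⊎ v ≡ lastOf x X ⊎ TwoNeighboursIn v (x ∷ X)
  on-path x X _ (here v≡x) = inj₁ v≡x
  on-path x (y ∷ Y) (x-y ∷ l , _ ∷ u) (there v∈) with on-path y Y (l , u) v∈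
  on-path x (y ∷ []) _ (there v∈) | inj₁ refl = inj₂ (inj₁ refl)
  on-path x (y ∷ z ∷ Y) (x-y ∷ y-z ∷ _ , (_ ∷ x≢z ∷ _) ∷ _) (there v∈) | inj₁ refl =
    inj₂ (inj₂ (x , z , adj-sym x-y , y-z , x≢z , here refl , there (there (here refl))))
  ... | inj₂ (inj₁ v≡end) = inj₂ (inj₁ v≡end)
  ... | inj₂ (inj₂ (p , q , v-p , v-q , p≢q , p∈ , q∈)) =
    inj₂ (inj₂ (p , q , v-p , v-q , p≢q , there p∈ , there q∈))

  leaf-on-path : ∀ {v} x X → Simple (x ∷ X) → v ∈ x ∷ X → deg v ≡ 1 → v ≡ x ⊎ v ≡ lastOf x X
  leaf-on-path x X s v∈ d1 with on-path x X s v∈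
  ... | inj₁ v≡x = inj₁ v≡x
  ... | inj₂ (inj₁ v≡end) = inj₂ v≡end
  ... | inj₂ (inj₂ (_ , _ , v-p , v-q , p≢q , _)) with () ← trans (sym d1) (internal v-p v-q p≢q)

  -- A vertex of a simple path other than its ends has at most one
  -- neighbour off the path (its degree is 3).
  one-neighbour-off : ∀ {v y z} x X → Simple (x ∷ X) → v ∈ x ∷ X → v ≢ x → v ≢ lastOf x X →
    Adj v y → Adj v z → y ∉ x ∷ X → z ∉ x ∷ X → y ≡ z
  one-neighbour-off {y = y} {z} x X s v∈ v≢x v≢end v-y v-z y∉ z∉ with on-path x X s v∈
  ... | inj₁ v≡x = ⊥-elim (v≢x v≡x)
  ... | inj₂ (inj₁ v≡end) = ⊥-elim (v≢end v≡end)
  ... | inj₂ (inj₂ (p , q , v-p , v-q , p≢q , p∈ , q∈)) with y ≟F z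
  ...   | yes y≡z = y≡z
  ...   | no y≢z  = ⊥-elim (no-four-neighbours v-p v-q v-y v-z p≢q
                      (apart p∈ y∉) (apart p∈ z∉) (apart q∈ y∉) (apart q∈ z∉) y≢z)
    where
    apart : ∀ {r s} → r ∈ x ∷ X → s ∉ x ∷ X → r ≢ s
    apart r∈ s∉ refl = s∉ r∈

-- Leaves hanging off a path.  Walking back along P from B, every
-- interior vertex b contributes the taxa reached by leaving P at b: one if
-- its off-path neighbour w is a leaf, two otherwise.
module HangingLeaves {n : ℕ} (T : UnrootedBinaryTree n) (A B : Fin n) (Prest : List (Fin (m T)))
  (simpleP : Tree.Simple T (leaf T A ∷ Prest)) (endP : lastOf (leaf T A) Prest ≡ leaf T B) where
  open Tree T

  a : V
  a = leaf T A

  P : List V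
  P = a ∷ Prest

  Reaches : List V → V → Fin n → Set
  Reaches pre b t = Σ (List V) λ S → Simple (a ∷ pre ++ b ∷ S) × lastOf a (pre ++ b ∷ S) ≡ leaf T t

  ReachesThrough : List V → V → V → Fin n → Set
  ReachesThrough pre b x t = Σ (List V) λ S → Simple (a ∷ pre ++ b ∷ x ∷ S) × lastOf a (pre ++ b ∷ x ∷ S) ≡ leaf T t

  through⇒reaches : ∀ {pre b x t} → ReachesThrough pre b x t → Reaches pre b t
  through⇒reaches {x = x} (S , s , e) = x ∷ S , s , e

  advance : ∀ pre b c t → Reaches (pre ++ [ b ]) c t → ReachesThrough pre b c t
  advance pre b c t (S , s , e) =
    S , subst (λ l → Simple (a ∷ l)) assoc s , subst (λ l → lastOf a l ≡ leaf T t) assoc e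
    where
    assoc : (pre ++ [ b ]) ++ c ∷ S ≡ pre ++ b ∷ c ∷ S
    assoc = ++-assoc pre [ b ] (c ∷ S)

  through-distinct : ∀ {pre b x y t t′} → ReachesThrough pre b x t → ReachesThrough pre b y t′ → x ≢ y → t ≢ t′
  through-distinct {pre} {b} {x} {y} (S , s , e) (S′ , s′ , e′) x≢y refl =
    branches-differ a pre b x y S S′ s s′ x≢y (trans e (sym e′))

  NextToPath : Fin n → Set
  NextToPath t = Σ V λ v → v ∈ P × Adj (leaf T t) v

  Tight : List V → List (Fin n) → Set
  Tight seg Ls = length seg ≤ length Ls × All NextToPath Ls ×
    (∀ v → v ∈ seg → v ≢ leaf T B → Σ (Fin n) λ t → t ∈ Ls × Adj v (leaf T t) × leaf T t ∉ P)

  record Collected (pre : List V) (b : V) (rest : List V) : Set where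
    field
      taxa     : List (Fin n)
      distinct : Unique taxa
      reached  : All (Reaches pre b) taxa
      outcome  : length (b ∷ rest) < length taxa ⊎ Tight (b ∷ rest) taxa

  at-least : ∀ {seg Ls} → length seg < length Ls ⊎ Tight seg Ls → length seg ≤ length Ls
  at-least (inj₁ more)  = <⇒≤ more
  at-least (inj₂ tight) = proj₁ tight

  module Step (pre : List V) (b c : V) (rest : List V) (split : pre ++ b ∷ c ∷ rest ≡ Prest) where

    onP : Simple (a ∷ pre ++ b ∷ c ∷ rest)
    onP = subst (λ l → Simple (a ∷ l)) (sym split) simpleP

    b∈P : b ∈ P
    b∈P = subst (b ∈_) (cong (a ∷_) split) (there (∈-++⁺ʳ pre (here refl)))

    p : V
    p = lastOf a pre

    p≢c : p ≢ c
    p≢c p≡c = Unique-disjoint (a ∷ pre) (proj₂ onP) (lastOf-∈ a pre) (there (here p≡c))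

    -- b has the two neighbours p and c on P, so it is internal and has a
    -- third neighbour w.
    third : Σ V λ z → Adj b z × z ≢ p × z ≢ c
    third = third-neighbour
      (internal (adj-sym (Linked-junction a pre b (c ∷ rest) (proj₁ onP))) (Linked-after a pre b c rest (proj₁ onP)) p≢c)
      p c

    w : V
    w = proj₁ third

    b-w : Adj b w
    b-w = proj₁ (proj₂ third)

    to-w : Simple (a ∷ pre ++ b ∷ w ∷ [])
    to-w = extend a pre (Simple-upto (a ∷ pre) b (c ∷ rest) onP) b-w (≢-sym (proj₁ (proj₂ (proj₂ third))))

    w≢c : w ≢ c
    w≢c = proj₂ (proj₂ (proj₂ third))

    w∉P : w ∉ P
    w∉P = subst (w ∉_) (cong (a ∷_) split) (off-path a pre b w c rest to-w onP w≢c)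

    beyond : ∀ z → Adj w z → z ≢ b → Σ (Fin n) (ReachesThrough (pre ++ [ b ]) w z)
    beyond z w-z z≢b =
      let (X , s , d1) = leaf-beyond a (pre ++ [ b ]) w z
            (subst (λ l → Simple (a ∷ l)) (sym (++-assoc pre [ b ] [ w ])) to-w) w-z
            (subst (_≢ z) (sym (lastOf-++-∷ a pre b [])) (≢-sym z≢b))
          (t , t-end) = leaf-surj T _ d1
      in t , X , s , trans (lastOf-++-∷ a (pre ++ [ b ]) w (z ∷ X)) (sym t-end)

    module _ (earlier : Collected (pre ++ [ b ]) c rest) where
      open Collected earlier using ()
        renaming (taxa to taxa₀; distinct to distinct₀; reached to reached₀; outcome to outcome₀)

      old : All (ReachesThrough pre b c) taxa₀
      old = All.map (λ {t} → advance pre b c t) reached₀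

      fresh : ∀ {t} → ReachesThrough pre b w t → All (t ≢_) taxa₀
      fresh r = All.map (λ r′ → through-distinct r r′ w≢c) old

      pendant : deg w ≡ 1 → Collected pre b (c ∷ rest)
      pendant d1 = record
        { taxa     = t ∷ taxa₀
        ; distinct = fresh via-w ∷ distinct₀
        ; reached  = through⇒reaches via-w ∷ All.map through⇒reaches old
        ; outcome  = grow outcome₀
        }
        where
        t : Fin n
        t = proj₁ (leaf-surj T w d1)
        t-w : leaf T t ≡ w
        t-w = proj₂ (leaf-surj T w d1)
        via-w : ReachesThrough pre b w t
        via-w = [] , to-w , trans (lastOf-++-∷ a pre b (w ∷ [])) (sym t-w)
        grow : length (c ∷ rest) < length taxa₀ ⊎ Tight (c ∷ rest) taxa₀ →
          length (b ∷ c ∷ rest) < length (t ∷ taxa₀) ⊎ Tight (b ∷ c ∷ rest) (t ∷ taxa₀)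
        grow (inj₁ more) = inj₁ (s≤s more)
        grow (inj₂ (len , next , pendants)) =
          inj₂ (s≤s len , (b , b∈P , subst (λ x → Adj x b) (sym t-w) (adj-sym b-w)) ∷ next , pendants′)
          where
          pendants′ : ∀ v → v ∈ b ∷ c ∷ rest → v ≢ leaf T B →
            Σ (Fin n) λ t′ → t′ ∈ t ∷ taxa₀ × Adj v (leaf T t′) × leaf T t′ ∉ P
          pendants′ v (here refl) _ = t , here refl , subst (Adj b) (sym t-w) b-w , subst (_∉ P) (sym t-w) w∉P
          pendants′ v (there v∈) v≢B =
            let (t′ , t′∈ , v-t′ , off) = pendants v v∈ v≢B in t′ , there t′∈ , v-t′ , off

      -- w is internal: leaving it towards its two other neighbours gives two
      -- new taxa, so the collected taxa outnumber the segment.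
      branching : deg w ≡ 3 → Collected pre b (c ∷ rest)
      branching d3 = record
        { taxa     = t₁ ∷ t₂ ∷ taxa₀
        ; distinct = (t₁≢t₂ ∷ fresh r₁) ∷ fresh r₂ ∷ distinct₀
        ; reached  = through⇒reaches r₁ ∷ through⇒reaches r₂ ∷ All.map through⇒reaches old
        ; outcome  = inj₁ (s≤s (s≤s (at-least outcome₀)))
        }
        where
        Z₁ = third-neighbour d3 b b
        Z₂ = third-neighbour d3 b (proj₁ Z₁)
        T₁ = beyond (proj₁ Z₁) (proj₁ (proj₂ Z₁)) (proj₁ (proj₂ (proj₂ Z₁)))
        T₂ = beyond (proj₁ Z₂) (proj₁ (proj₂ Z₂)) (proj₁ (proj₂ (proj₂ Z₂)))
        t₁ t₂ : Fin n
        t₁ = proj₁ T₁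
        t₂ = proj₁ T₂
        t₁≢t₂ : t₁ ≢ t₂
        t₁≢t₂ = through-distinct (proj₂ T₁) (proj₂ T₂) (≢-sym (proj₂ (proj₂ (proj₂ Z₂))))
        r₁ : ReachesThrough pre b w t₁
        r₁ = advance pre b w t₁ (through⇒reaches (proj₂ T₁))
        r₂ : ReachesThrough pre b w t₂
        r₂ = advance pre b w t₂ (through⇒reaches (proj₂ T₂))

    step : Collected (pre ++ [ b ]) c rest → Collected pre b (c ∷ rest)
    step earlier with deg13 T w
    ... | inj₁ d1 = pendant earlier d1
    ... | inj₂ d3 = branching earlier d3

  collect : ∀ pre b rest → pre ++ b ∷ rest ≡ Prest → Collected pre b rest
  collect pre b (c ∷ rest) split =
    Step.step pre b c rest split (collect (pre ++ [ b ]) c rest (trans (++-assoc pre [ b ] (c ∷ rest)) split))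
  collect pre b [] split = record
    { taxa     = B ∷ []
    ; distinct = [] ∷ []
    ; reached  = ([] , onP , end) ∷ []
    ; outcome  = inj₂ (s≤s z≤n , next ∷ [] , λ { v (here refl) b≢B → ⊥-elim (b≢B b≡B) })
    }
    where
    onP : Simple (a ∷ pre ++ b ∷ [])
    onP = subst (λ l → Simple (a ∷ l)) (sym split) simpleP
    end : lastOf a (pre ++ b ∷ []) ≡ leaf T B
    end = trans (cong (lastOf a) split) endP
    b≡B : b ≡ leaf T B
    b≡B = trans (sym (lastOf-++-∷ a pre b [])) end
    next : NextToPath B
    next = lastOf a pre , subst (lastOf a pre ∈_) (cong (a ∷_) split) (∈-++⁺ˡ (lastOf-∈ a pre)) ,
           subst (λ x → Adj x (lastOf a pre)) b≡B (adj-sym (Linked-junction a pre b [] (proj₁ onP)))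

-- The hanging taxa cannot
-- outnumber the interior of the path, so they fit it tightly: every taxon
-- is next to the path, and the cherries are A with the pendant leaf C at
-- A's neighbour b, and B with the pendant leaf D at B's neighbour u.
module LongPath {n : ℕ} (T : UnrootedBinaryTree n) (A B : Fin n) (b : Fin (m T)) (rest : List (Fin (m T)))
  (simpleP : Tree.Simple T (leaf T A ∷ b ∷ rest)) (endP : lastOf (leaf T A) (b ∷ rest) ≡ leaf T B)
  (d : ℕ) (lengthP : length (b ∷ rest) ≡ d) (few-taxa : n ≤ suc d) (long : 3 ≤ d) where
  open Tree T
  open HangingLeaves T A B (b ∷ rest) simpleP endP
  open FinCounting n using () renaming (unique-length to taxa-bound)
  open DecMembership (_≟F_ {n}) using () renaming (_∈?_ to _∈?ₜ_)
  open DecMembership (_≟F_ {m T}) using () renaming (_∈?_ to _∈?ᵥ_)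

  a-b : Adj a b
  a-b with l ∷ _ ← proj₁ simpleP = l

  B∈P : leaf T B ∈ P
  B∈P = subst (_∈ P) endP (lastOf-∈ a (b ∷ rest))

  on≢off : ∀ {x y} → x ∈ P → y ∉ P → x ≢ y
  on≢off x∈ y∉ refl = y∉ x∈

  -- By uniqueness of paths, a and the leaf of B are at distance exactly d ≥ 3.
  too-short : ∀ X → Simple (a ∷ X) → lastOf a X ≡ leaf T B → length X < 3 → ⊥
  too-short X s end lt = <⇒≱ lt (subst (3 ≤_) (sym length≡d) long)
    where
    length≡d : length X ≡ d
    length≡d = trans (cong length (path-unique a X (b ∷ rest) s simpleP (trans end (sym endP)))) lengthP

  a≢B : a ≢ leaf T B
  a≢B e = too-short [] ([-] , [] ∷ []) e (s≤s z≤n)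

  not-adjacent : ¬ Adj a (leaf T B)
  not-adjacent a-B = too-short (leaf T B ∷ []) (a-B ∷ [-] , (a≢B ∷ []) ∷ [] ∷ []) refl (s≤s (s≤s z≤n))

  no-common-neighbour : ∀ c → Adj a c → ¬ Adj c (leaf T B)
  no-common-neighbour c a-c c-B = too-short (c ∷ leaf T B ∷ [])
    (a-c ∷ c-B ∷ [-] , (adj-irrefl a-c ∷ a≢B ∷ []) ∷ (adj-irrefl c-B ∷ []) ∷ [] ∷ [])
    refl (s≤s (s≤s (s≤s z≤n)))

  leaf-on-P : ∀ {v} → v ∈ P → deg v ≡ 1 → v ≡ a ⊎ v ≡ leaf T B
  leaf-on-P v∈ d1 = Sum.map₂ (λ e → trans e endP) (leaf-on-path a (b ∷ rest) simpleP v∈ d1)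

  one-off-P : ∀ {v y z} → v ∈ P → v ≢ a → v ≢ leaf T B → Adj v y → Adj v z → y ∉ P → z ∉ P → y ≡ z
  one-off-P v∈ v≢a v≢B = one-neighbour-off a (b ∷ rest) simpleP v∈ v≢a (λ e → v≢B (trans e endP))

  open Collected (collect [] b rest refl)

  -- A is not collected: the collected taxa are reached from a through b.
  A∉taxa : All (A ≢_) taxa
  A∉taxa = All.map not-A reached
    where
    []≢∷ : ∀ {x : V} {xs} → _≢_ {A = List V} [] (x ∷ xs)
    []≢∷ ()
    not-A : ∀ {t} → Reaches [] b t → A ≢ t
    not-A (S , s , end) A≡t =
      []≢∷ (path-unique a [] (b ∷ S) ([-] , [] ∷ []) s (trans (cong (leaf T) A≡t) (sym end)))

  -- With n ≤ d + 1, the collected taxa cannot outnumber the d vertices of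
  -- b ∷ rest, so they fit tightly; then every taxon is A or collected.
  tight : Tight (b ∷ rest) taxa
  tight with outcome
  ... | inj₂ fits = fits
  ... | inj₁ more = ⊥-elim (<⇒≱ (≤-trans (s≤s few-taxa) (s≤s (subst (_< length taxa) lengthP more)))
                                (taxa-bound (A ∷ taxa) (A∉taxa ∷ distinct)))

  all-taxa : ∀ t → t ∈ A ∷ taxa
  all-taxa t with t ∈?ₜ (A ∷ taxa)
  ... | yes t∈ = t∈
  ... | no t∉  = ⊥-elim (<⇒≱ (s≤s (≤-trans few-taxa (s≤s (subst (_≤ length taxa) lengthP (proj₁ tight)))))
                               (taxa-bound (t ∷ A ∷ taxa) (AllP.¬Any⇒All¬ _ t∉ ∷ A∉taxa ∷ distinct)))

  next-to-path : ∀ t → NextToPath t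
  next-to-path t with all-taxa t
  ... | here refl = b , there (here refl) , a-b
  ... | there t∈  = All.lookup (proj₁ (proj₂ tight)) t∈

  pendant-at : ∀ v → v ∈ b ∷ rest → v ≢ leaf T B → Σ (Fin n) λ t → Adj v (leaf T t) × leaf T t ∉ P
  pendant-at v v∈ v≢B = let (t , _ , v-t , off) = proj₂ (proj₂ tight) v v∈ v≢B in t , v-t , off

  b≢B : b ≢ leaf T B
  b≢B e = not-adjacent (subst (Adj a) e a-b)

  C : Fin n
  C = proj₁ (pendant-at b (here refl) b≢B)

  b-C : Adj b (leaf T C)
  b-C = proj₁ (proj₂ (pendant-at b (here refl) b≢B))

  C∉P : leaf T C ∉ P
  C∉P = proj₂ (proj₂ (pendant-at b (here refl) b≢B))

  u : V
  u = proj₁ (next-to-path B)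

  u∈P : u ∈ P
  u∈P = proj₁ (proj₂ (next-to-path B))

  B-u : Adj (leaf T B) u
  B-u = proj₂ (proj₂ (next-to-path B))

  u≢a : u ≢ a
  u≢a e = not-adjacent (adj-sym (subst (Adj (leaf T B)) e B-u))

  u≢B : u ≢ leaf T B
  u≢B e = adj-irrefl B-u (sym e)

  u∈rest : u ∈ b ∷ rest
  u∈rest with u∈P
  ... | here u≡a = ⊥-elim (u≢a u≡a)
  ... | there u∈ = u∈

  D : Fin n
  D = proj₁ (pendant-at u u∈rest u≢B)

  u-D : Adj u (leaf T D)
  u-D = proj₁ (proj₂ (pendant-at u u∈rest u≢B))

  D∉P : leaf T D ∉ P
  D∉P = proj₂ (proj₂ (pendant-at u u∈rest u≢B))

  cherry-AC : Cherry T A C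
  cherry-AC = (λ A≡C → C∉P (subst (λ t → leaf T t ∈ P) A≡C (here refl))) ,
    (a ∷ b ∷ leaf T C ∷ []) , (a-b ∷ b-C ∷ [-]) ,
    ((adj-irrefl a-b ∷ on≢off (here refl) C∉P ∷ []) ∷ (adj-irrefl b-C ∷ []) ∷ [] ∷ []) , refl , refl , refl

  cherry-BD : Cherry T B D
  cherry-BD = (λ B≡D → D∉P (subst (λ t → leaf T t ∈ P) B≡D B∈P)) ,
    (leaf T B ∷ u ∷ leaf T D ∷ []) , (B-u ∷ u-D ∷ [-]) ,
    ((adj-irrefl B-u ∷ on≢off B∈P D∉P ∷ []) ∷ (adj-irrefl u-D ∷ []) ∷ [] ∷ []) , refl , refl , refl

  different-cherries : ¬ SamePair A C B D
  different-cherries (inj₁ (A≡B , _)) = a≢B (cong (leaf T) A≡B)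
  different-cherries (inj₂ (A≡D , _)) = D∉P (subst (λ t → leaf T t ∈ P) A≡D (here refl))

  -- A cherry {X, Y} with common neighbour c and X on P is {A, C} or {B, D}:
  -- X is an end of P, c is then b or u, and Y is its pendant leaf.
  classify : ∀ X Y c → X ≢ Y → Adj c (leaf T X) → Adj c (leaf T Y) → leaf T X ∈ P →
    SamePair X Y A C ⊎ SamePair X Y B D
  classify X Y c X≢Y c-X c-Y X∈P with leaf-on-P X∈P (leaf-deg T X)
  ... | inj₁ X≡a = inj₁ (inj₁ (leaf-inj T X≡a , Y≡C))
    where
    b-Y : Adj b (leaf T Y)
    b-Y = subst (λ x → Adj x (leaf T Y))
      (leaf-neighbour (leaf-deg T A) (subst (λ x → Adj x c) X≡a (adj-sym c-X)) a-b) c-Y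
    Y≡C : Y ≡ C
    Y≡C with leaf T Y ∈?ᵥ P
    ... | no Y∉P = leaf-inj T (one-off-P (there (here refl)) (≢-sym (adj-irrefl a-b)) b≢B b-Y b-C Y∉P C∉P)
    ... | yes Y∈P with leaf-on-P Y∈P (leaf-deg T Y)
    ...   | inj₁ Y≡a = ⊥-elim (X≢Y (leaf-inj T (trans X≡a (sym Y≡a))))
    ...   | inj₂ Y≡B = ⊥-elim (no-common-neighbour b a-b (subst (Adj b) Y≡B b-Y))
  ... | inj₂ X≡B = inj₂ (inj₁ (leaf-inj T X≡B , Y≡D))
    where
    u-Y : Adj u (leaf T Y)
    u-Y = subst (λ x → Adj x (leaf T Y))
      (leaf-neighbour (leaf-deg T B) (subst (λ x → Adj x c) X≡B (adj-sym c-X)) B-u) c-Y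
    Y≡D : Y ≡ D
    Y≡D with leaf T Y ∈?ᵥ P
    ... | no Y∉P = leaf-inj T (one-off-P u∈P u≢a u≢B u-Y u-D Y∉P D∉P)
    ... | yes Y∈P with leaf-on-P Y∈P (leaf-deg T Y)
    ...   | inj₂ Y≡B = ⊥-elim (X≢Y (leaf-inj T (trans X≡B (sym Y≡B))))
    ...   | inj₁ Y≡a = ⊥-elim (no-common-neighbour u (adj-sym (subst (Adj u) Y≡a u-Y)) (adj-sym B-u))

  swap-pair : ∀ {X Y E F : Fin n} → SamePair Y X E F → SamePair X Y E F
  swap-pair (inj₁ (Y≡E , X≡F)) = inj₂ (X≡F , Y≡E)
  swap-pair (inj₂ (Y≡F , X≡E)) = inj₁ (X≡E , Y≡F)

  -- If neither of its leaves were on P,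
  -- their common neighbour c (on P, as every taxon is next to P) would be an
  -- interior vertex of P with two neighbours off P.
  all-cherries : ∀ X Y → Cherry T X Y → SamePair X Y A C ⊎ SamePair X Y B D
  all-cherries X Y (X≢Y , (._ ∷ c ∷ ._ ∷ []) , (X-c ∷ c-Y ∷ [-]) , _ , refl , refl , refl)
    with leaf T X ∈?ᵥ P | leaf T Y ∈?ᵥ P
  ... | yes X∈P | _       = classify X Y c X≢Y (adj-sym X-c) c-Y X∈P
  ... | no _    | yes Y∈P = Sum.map swap-pair swap-pair (classify Y X c (≢-sym X≢Y) c-Y (adj-sym X-c) Y∈P)
  ... | no X∉P  | no Y∉P  = ⊥-elim (X≢Y (leaf-inj T (one-off-P c∈P c≢a c≢B (adj-sym X-c) c-Y X∉P Y∉P)))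
    where
    c∈P : c ∈ P
    c∈P = let (v , v∈P , X-v) = next-to-path X in
      subst (_∈ P) (leaf-neighbour (leaf-deg T X) X-v X-c) v∈P
    c-internal : deg c ≡ 3
    c-internal = internal (adj-sym X-c) c-Y (λ e → X≢Y (leaf-inj T e))
    c≢a : c ≢ a
    c≢a refl with () ← trans (sym c-internal) (leaf-deg T A)
    c≢B : c ≢ leaf T B
    c≢B refl with () ← trans (sym c-internal) (leaf-deg T B)

  caterpillar : Caterpillar T
  caterpillar = A , C , B , D , cherry-AC , cherry-BD , different-cherries , all-cherries

module Distances {n : ℕ} (T : UnrootedBinaryTree n) where
  open Tree T

  as-path : ∀ {A B d} → Eps T A B d →
    Σ (List V) λ X → Simple (leaf T A ∷ X) × lastOf (leaf T A) X ≡ leaf T B × length X ≡ d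
  as-path (x ∷ X , linked , unique , refl , end , len) =
    X , (linked , unique) , just-injective (trans (sym (last-∷ x X)) end) , suc-injective len

  eps-unique : ∀ {A B d₁ d₂} → Eps T A B d₁ → Eps T A B d₂ → d₁ ≡ d₂
  eps-unique {A} e₁ e₂ =
    let (X , s₁ , end₁ , len₁) = as-path e₁
        (Y , s₂ , end₂ , len₂) = as-path e₂
    in trans (sym len₁) (trans (cong length (path-unique (leaf T A) X Y s₁ s₂ (trans end₁ (sym end₂)))) len₂)

  eps-self : ∀ {A d} → Eps T A A d → d ≡ 0
  eps-self e = eps-unique e (leaf T _ ∷ [] , [-] , [] ∷ [] , refl , refl , refl)

  dist : Fin n → Fin n → ℕ
  dist A B = proj₁ (connected T (leaf T A) (leaf T B))

  dist-eps : ∀ A B → Eps T A B (dist A B)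
  dist-eps A B = proj₂ (connected T (leaf T A) (leaf T B))

  -- If the leaves of A and B are adjacent, there is no third taxon: the path
  -- from A to it would have to pass through B's leaf and then return to A's.
  adjacent-leaves : ∀ A B C → C ≢ A → C ≢ B → ¬ Adj (leaf T A) (leaf T B)
  adjacent-leaves A B C C≢A C≢B A-B with as-path (dist-eps A C)
  ... | [] , _ , end , _ = C≢A (leaf-inj T (sym end))
  ... | q ∷ [] , (A-q ∷ _ , _) , end , _ =
    C≢B (leaf-inj T (trans (sym end) (sym (leaf-neighbour (leaf-deg T A) A-B A-q))))
  ... | q ∷ r ∷ _ , (A-q ∷ q-r ∷ _ , (_ ∷ A≢r ∷ _) ∷ _) , _ , _ =
    A≢r (sym (leaf-neighbour (leaf-deg T B) (subst (λ x → Adj x r) q≡B q-r) (adj-sym A-B)))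
    where
    q≡B : q ≡ leaf T B
    q≡B = leaf-neighbour (leaf-deg T A) A-q A-B

  distance≥2 : ∀ {A B C d} → A ≢ B → C ≢ A → C ≢ B → Eps T A B d → 2 ≤ d
  distance≥2 {A} {B} {C} A≢B C≢A C≢B e with as-path e
  ... | [] , _ , end , _ = ⊥-elim (A≢B (leaf-inj T end))
  ... | q ∷ [] , (A-q ∷ _ , _) , end , _ = ⊥-elim (adjacent-leaves A B C C≢A C≢B (subst (Adj (leaf T A)) end A-q))
  ... | _ ∷ _ ∷ _ , _ , _ , refl = s≤s (s≤s z≤n)

  long-path-caterpillar : ∀ {A B d} → Eps T A B d → n ≤ suc d → 3 ≤ d → Caterpillar T
  long-path-caterpillar {A} {B} {d} e few long with as-path e
  ... | [] , _ , _ , refl with () ← long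
  ... | b ∷ rest , s , end , len = LongPath.caterpillar T A B b rest s end d len few long

open Distances using (dist; dist-eps; eps-unique; eps-self; distance≥2; long-path-caterpillar)

third-taxon : ∀ {k} (A B : Fin (3 + k)) → Σ (Fin (3 + k)) λ C → C ≢ A × C ≢ B
third-taxon {k} A B with any? (λ C → ¬? (C ≟F A) ×-dec ¬? (C ≟F B))
... | yes found = found
... | no none = ⊥-elim (<-irrefl refl (≤-trans (m≤m+n 3 k)
      (≤-trans (≤-reflexive (sym count-all)) (count-two (λ _ → true) A B only))))
  where
  open FinCounting (3 + k) using (count-all; count-two)
  only : ∀ C → true ≡ true → C ≡ A ⊎ C ≡ B
  only C _ with C ≟F A | C ≟F B
  ... | yes C≡A | _       = inj₁ C≡A
  ... | no _    | yes C≡B = inj₂ C≡B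
  ... | no C≢A  | no C≢B  = ⊥-elim (none (C , C≢A , C≢B))

∣-∣≤ : ∀ x y k → x ≤ y + k → y ≤ x + k → ∣ x - y ∣ ≤ k
∣-∣≤ zero    y       k _       y≤k     = y≤k
∣-∣≤ (suc x) zero    k x<k     _       = x<k
∣-∣≤ (suc x) (suc y) k (s≤s p) (s≤s q) = ∣-∣≤ x y k p q

one-is-far : ∀ x y k → ¬ (∣ x - y ∣ ≤ k) → 2 ≤ x → 2 ≤ y → 3 + k ≤ x ⊎ 3 + k ≤ y
one-is-far x y k far 2≤x 2≤y with x ≤? y + k | y ≤? x + k
... | no x-far | _        = inj₁ (≤-trans (s≤s (+-monoˡ-≤ k 2≤y)) (≰⇒> x-far))
... | yes _    | no y-far = inj₂ (≤-trans (s≤s (+-monoˡ-≤ k 2≤x)) (≰⇒> y-far))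
... | yes x≤   | yes y≤   = ⊥-elim (far (∣-∣≤ x y k x≤ y≤))

-- A failure of k-IC is witnessed by a pair of taxa whose path lengths
-- differ by more than k (a decidable property, since ε is a function).
IC-violation : ∀ {n} k (T T′ : UnrootedBinaryTree n) → ¬ IC k T T′ →
  Σ (Fin n) λ A → Σ (Fin n) λ B → ¬ (∣ dist T A B - dist T′ A B ∣ ≤ k)
IC-violation k T T′ ¬ic with any? (λ A → any? (λ B → ¬? (∣ dist T A B - dist T′ A B ∣ ≤? k)))
... | yes violation = violation
... | no none       = ⊥-elim (¬ic ic)
  where
  ic : IC k T T′
  ic A B d₁ d₂ e₁ e₂ with ∣ dist T A B - dist T′ A B ∣ ≤? k
  ... | no far    = ⊥-elim (none (A , B , far))
  ... | yes close = subst₂ (λ x y → ∣ x - y ∣ ≤ k)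
                      (eps-unique T (dist-eps T A B) e₁) (eps-unique T′ (dist-eps T′ A B) e₂) close

-- On 4 + k taxa, a pair A, B whose path lengths in T and T′ differ by more
-- than k is at distance ≥ k + 3 = n − 1 in one of the trees, which is then
-- a caterpillar.
far-pair : ∀ k (T T′ : UnrootedBinaryTree (4 + k)) A B → ¬ (∣ dist T A B - dist T′ A B ∣ ≤ k) →
  Caterpillar T ⊎ Caterpillar T′
far-pair k T T′ A B far =
  Sum.map (long-path T) (long-path T′) (one-is-far _ _ k far (at-least-2 T) (at-least-2 T′))
  where
  A≢B : A ≢ B
  A≢B refl = far (subst₂ (λ x y → ∣ x - y ∣ ≤ k)
    (sym (eps-self T (dist-eps T A A))) (sym (eps-self T′ (dist-eps T′ A A))) z≤n)
  at-least-2 : ∀ U → 2 ≤ dist U A B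
  at-least-2 U = let (C , C≢A , C≢B) = third-taxon A B in distance≥2 U A≢B C≢A C≢B (dist-eps U A B)
  long-path : ∀ U → 3 + k ≤ dist U A B → Caterpillar U
  long-path U far′ = long-path-caterpillar U (dist-eps U A B) (s≤s far′) (≤-trans (m≤m+n 3 k) far′)

corollary1 : (n : ℕ) → 4 ≤ n → (T T′ : UnrootedBinaryTree n) →
    PreciselyIC (n ∸ 3) T T′ → Caterpillar T ⊎ Caterpillar T′
corollary1 (suc (suc (suc (suc k)))) _ T T′ (_ , ¬ic) =
  let (A , B , far) = IC-violation k T T′ ¬ic in far-pair k T T′ A B far
corollary1 1 (s≤s ())             _ _ _
corollary1 2 (s≤s (s≤s ()))       _ _ _
corollary1 3 (s≤s (s≤s (s≤s ()))) _ _ _
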